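{- Let $T$ be a tournament on $n$ vertices with adjacency matrix $A$, and let $k \geq 4$ be an even integer. Then $$\mathrm{tr}(A^k) = 2\,\mathrm{ec}_k(T) - (n-1)^k - (n-1).$$ In particular, for a sequence of tournaments with $n \to \infty$, $\mathrm{ec}_k(T) = (1/2 \pm o(1)) n^k$ if and only if $|\mathrm{tr}(A^k)| = o(n^k)$.
   Context: A tournament $T=(V,E)$ on $n=|V|$ vertices is a directed graph such that for any two distinct vertices $u,v$ exactly one of $(u,v)$, $(v,u)$ is in $E$. Its adjacency matrix $A$ is the $V\times V$ matrix with $A_{u,v}=1$ if $(u,v)\in E$, $A_{u,v}=-1$ if $(v,u)\in E$, and $A_{u,u}=0$. A $k$-cycle is an ordered sequence of vertices $(v_1, \ldots, v_k, v_1)$ (vertices may repeat) with $v_i \neq v_{i+1}$ for $i \leq k-1$ and $v_k \neq v_1$. It is even if the number of indices $i\in\{1,\dots,k\}$ for which the edge between $v_i$ and $v_{i+1}$ (with $v_{k+1}=v_1$) is directed from $v_{i+1}$ to $v_i$ is even. $\mathrm{ec}_k(T)$ is the number of even $k$-cycles in $T$, and $\mathrm{tr}$ denotes the trace. -}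

module Defs where

open import Data.Bool using (Bool; true; false; not; if_then_else_; _∧_)
open import Data.Nat as ℕ using (ℕ; zero; suc)
open import Data.Integer as ℤ using (ℤ; +_; -_; _+_; _*_; 0ℤ; 1ℤ)
open import Data.Fin using (Fin; _≟_)
open import Data.Fin.Properties using ()
open import Data.List as List using (List; []; _∷_; _++_; [_]; length; filter; concatMap; map)
open import Data.Vec as Vec using (Vec; toList)
open import Data.Product using (_×_; _,_)
open import Relation.Nullary using (does)
open import Relation.Binary.PropositionalEquality using (_≡_; _≢_)

-- A tournament on the vertex set Fin n: out u v = true means the edge (u,v) ∈ E.
record Tournament (n : ℕ) : Set where
  field
    out     : Fin n → Fin n → Bool
    irrefl  : ∀ u → out u u ≡ false
    tourn   : ∀ u v → u ≢ v → out v u ≡ not (out u v)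
open Tournament public

∑ : (n : ℕ) → (Fin n → ℤ) → ℤ
∑ zero    f = 0ℤ
∑ (suc n) f = f Fin.zero + ∑ n (λ i → f (Fin.suc i))

Matrix : ℕ → Set
Matrix n = Fin n → Fin n → ℤ

adj : ∀ {n} → Tournament n → Matrix n
adj T u v = if does (u ≟ v) then 0ℤ else (if out T u v then 1ℤ else - 1ℤ)

idM : ∀ {n} → Matrix n
idM u v = if does (u ≟ v) then 1ℤ else 0ℤ

_⊗_ : ∀ {n} → Matrix n → Matrix n → Matrix n
_⊗_ {n} A B u v = ∑ n (λ w → A u w * B w v)

_^M_ : ∀ {n} → Matrix n → ℕ → Matrix n
A ^M zero    = idM
A ^M (suc k) = A ⊗ (A ^M k)

tr : ∀ {n} → Matrix n → ℤ
tr {n} A = ∑ n (λ i → A i i)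

allFin : (n : ℕ) → List (Fin n)
allFin n = Vec.toList (Vec.allFin n)

allSeqs : (n k : ℕ) → List (Vec (Fin n) k)
allSeqs n zero    = Vec.[] ∷ []
allSeqs n (suc k) = concatMap (λ v → map (v Vec.∷_) (allSeqs n k)) (allFin n)

consec : ∀ {A : Set} → List A → List (A × A)
consec []           = []
consec (x ∷ [])     = []
consec (x ∷ y ∷ xs) = (x , y) ∷ consec (y ∷ xs)

closedPairs : ∀ {A : Set} → List A → List (A × A)
closedPairs []       = []
closedPairs (x ∷ xs) = consec (x ∷ xs ++ [ x ])

evenB : ℕ → Bool
evenB zero    = true
evenB (suc m) = not (evenB m)

module _ {n : ℕ} (T : Tournament n) where
  -- v_i ≠ v_{i+1} for all i (cyclically)
  isCycle : List (Fin n × Fin n) → Bool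
  isCycle []            = true
  isCycle ((a , b) ∷ ps) = not (does (a ≟ b)) ∧ isCycle ps

  backward : List (Fin n × Fin n) → ℕ
  backward []             = 0
  backward ((a , b) ∷ ps) = (if out T b a then 1 else 0) ℕ.+ backward ps

  isEvenCycle : ∀ {k} → Vec (Fin n) k → Bool
  isEvenCycle w = let ps = closedPairs (toList w) in isCycle ps ∧ evenB (backward ps)

-- ec_k(T): number of even k-cycles (ordered sequences of vertices).
ec : ∀ {n} → ℕ → Tournament n → ℕ
ec {n} k T = length (filter (λ w → isEvenCycle T w Data.Bool.≟ true) (allSeqs n k))

-- Expanding the matrix power, tr(M^k) is the sum over all closed vertex sequences
-- (v₁, …, v_k, v₁) of the product of the entries M_{v_i v_{i+1}} (module TraceIdentity, Walks).
-- For M = A this product is 0 unless the sequence is a k-cycle, and then it is +1 or −1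
-- according to the parity of its backward edges, i.e. it equals 2·[even cycle] − [cycle].
-- For M = J − I, the matrix of the complete graph, the product is [cycle].  Hence
--   tr(A^k) = 2 ec_k(T) − tr((J − I)^k),
-- and tr((J − I)^k) = (n − 1)^k + (n − 1)(−1)^k is computed from (J − I)^k = c_k J + (−1)^k I.
-- For the asymptotic part (module Asymptotics) we bound the error term: N^k and
-- (N − 1)^k + (N − 1) differ by at most k N^{k−1} = o(N^k) (a Bernoulli-type inequality), so
-- |tr(A^k)| and |2 ec_k(T) − N^k| differ by a negligible amount (module Distance), and an
-- abstract transfer lemma for little-o bounds gives the equivalence.
module Submission where

open import Defs

module TraceIdentity where

  open import Data.Bool using (Bool; true; false; not; _∧_; if_then_else_)
  open import Data.Bool.Properties using () renaming (_≟_ to _≟ᵇ_)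
  open import Data.Nat as ℕ using (ℕ; zero; suc)
  open import Data.Integer using (ℤ; +_; _+_; _*_; _-_; _^_; 0ℤ; 1ℤ; -1ℤ)
  import Data.Integer.Properties as ℤP
  open import Data.Integer.Tactic.RingSolver using (solve-∀)
  open import Data.Fin using (Fin; _≟_)
  open import Data.List using (List; []; _∷_; _++_; [_]; length; filter; concatMap; map)
  open import Data.Vec as Vec using (Vec; toList)
  open import Data.Product using (_×_; _,_)
  open import Data.Empty using (⊥-elim)
  open import Relation.Nullary using (does; yes; no)
  open import Relation.Binary.PropositionalEquality hiding ([_])
  open ≡-Reasoning

  sumL : {X : Set} → List X → (X → ℤ) → ℤ
  sumL []       f = 0ℤ
  sumL (x ∷ xs) f = f x + sumL xs f

  sumL-cong : {X : Set} (xs : List X) {f g : X → ℤ} → (∀ x → f x ≡ g x) → sumL xs f ≡ sumL xs g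
  sumL-cong []       f≗g = refl
  sumL-cong (x ∷ xs) f≗g = cong₂ _+_ (f≗g x) (sumL-cong xs f≗g)

  sumL-++ : {X : Set} (xs ys : List X) (f : X → ℤ) → sumL (xs ++ ys) f ≡ sumL xs f + sumL ys f
  sumL-++ []       ys f = sym (ℤP.+-identityˡ _)
  sumL-++ (x ∷ xs) ys f = trans (cong (_+_ (f x)) (sumL-++ xs ys f)) (sym (ℤP.+-assoc (f x) _ _))

  sumL-map : {X Y : Set} (h : X → Y) (xs : List X) (f : Y → ℤ) → sumL (map h xs) f ≡ sumL xs (λ x → f (h x))
  sumL-map h []       f = refl
  sumL-map h (x ∷ xs) f = cong (_+_ (f (h x))) (sumL-map h xs f)

  sumL-concatMap : {X Y : Set} (h : X → List Y) (xs : List X) (f : Y → ℤ) →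
    sumL (concatMap h xs) f ≡ sumL xs (λ x → sumL (h x) f)
  sumL-concatMap h []       f = refl
  sumL-concatMap h (x ∷ xs) f = trans (sumL-++ (h x) _ f) (cong (_+_ (sumL (h x) f)) (sumL-concatMap h xs f))

  sumL-scale : {X : Set} (c : ℤ) (xs : List X) (f : X → ℤ) → sumL xs (λ x → c * f x) ≡ c * sumL xs f
  sumL-scale c []       f = sym (ℤP.*-zeroʳ c)
  sumL-scale c (x ∷ xs) f = trans (cong (_+_ (c * f x)) (sumL-scale c xs f)) (sym (ℤP.*-distribˡ-+ c (f x) _))

  sumL-+ : {X : Set} (xs : List X) (f g : X → ℤ) → sumL xs (λ x → f x + g x) ≡ sumL xs f + sumL xs g
  sumL-+ []       f g = refl
  sumL-+ (x ∷ xs) f g = trans (cong (_+_ (f x + g x)) (sumL-+ xs f g)) (interchange (f x) (g x) _ _)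
    where
    interchange : ∀ a b c d → a + b + (c + d) ≡ a + c + (b + d)
    interchange = solve-∀

  sumL-- : {X : Set} (xs : List X) (f g : X → ℤ) → sumL xs (λ x → f x - g x) ≡ sumL xs f - sumL xs g
  sumL-- []       f g = refl
  sumL-- (x ∷ xs) f g = trans (cong (_+_ (f x - g x)) (sumL-- xs f g)) (interchange (f x) (g x) _ _)
    where
    interchange : ∀ a b c d → a - b + (c - d) ≡ a + c - (b + d)
    interchange = solve-∀

  sumL-tabulate : {X : Set} (n : ℕ) (g : Fin n → X) (f : X → ℤ) →
    sumL (toList (Vec.tabulate g)) f ≡ ∑ n (λ i → f (g i))
  sumL-tabulate zero    g f = refl
  sumL-tabulate (suc n) g f = cong (_+_ (f (g Fin.zero))) (sumL-tabulate n (λ i → g (Fin.suc i)) f)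

  ∑-as-sumL : ∀ n (f : Fin n → ℤ) → ∑ n f ≡ sumL (allFin n) f
  ∑-as-sumL n f = sym (sumL-tabulate n (λ i → i) f)

  ∑-cong : ∀ n {f g : Fin n → ℤ} → (∀ i → f i ≡ g i) → ∑ n f ≡ ∑ n g
  ∑-cong n {f} {g} f≗g = trans (∑-as-sumL n f) (trans (sumL-cong (allFin n) f≗g) (sym (∑-as-sumL n g)))

  ∑-+ : ∀ n (f g : Fin n → ℤ) → ∑ n (λ i → f i + g i) ≡ ∑ n f + ∑ n g
  ∑-+ n f g = trans (∑-as-sumL n _) (trans (sumL-+ (allFin n) f g) (sym (cong₂ _+_ (∑-as-sumL n f) (∑-as-sumL n g))))

  ∑-- : ∀ n (f g : Fin n → ℤ) → ∑ n (λ i → f i - g i) ≡ ∑ n f - ∑ n g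
  ∑-- n f g = trans (∑-as-sumL n _) (trans (sumL-- (allFin n) f g) (sym (cong₂ _-_ (∑-as-sumL n f) (∑-as-sumL n g))))

  ∑-const : ∀ n (c : ℤ) → ∑ n (λ _ → c) ≡ + n * c
  ∑-const zero    c = refl
  ∑-const (suc n) c = trans (cong (_+_ c) (∑-const n c)) (sym (ℤP.suc-* (+ n) c))

  ∑-δ : ∀ n (f : Fin n → ℤ) (v : Fin n) → ∑ n (λ w → f w * idM w v) ≡ f v
  ∑-δ (suc n) f Fin.zero = begin
      f Fin.zero * 1ℤ + ∑ n (λ w → f (Fin.suc w) * 0ℤ)
    ≡⟨ cong₂ _+_ (ℤP.*-identityʳ (f Fin.zero)) (∑-cong n (λ w → ℤP.*-zeroʳ (f (Fin.suc w)))) ⟩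
      f Fin.zero + ∑ n (λ _ → 0ℤ)
    ≡⟨ cong (_+_ (f Fin.zero)) (trans (∑-const n 0ℤ) (ℤP.*-zeroʳ (+ n))) ⟩
      f Fin.zero + 0ℤ
    ≡⟨ ℤP.+-identityʳ _ ⟩
      f Fin.zero
    ∎
  ∑-δ (suc n) f (Fin.suc v) =
    trans (cong₂ _+_ (ℤP.*-zeroʳ (f Fin.zero)) (∑-δ n (λ w → f (Fin.suc w)) v)) (ℤP.+-identityˡ _)

  idM-diag : ∀ {n} (u : Fin n) → idM u u ≡ 1ℤ
  idM-diag u with u ≟ u
  ... | yes _   = refl
  ... | no u≢u  = ⊥-elim (u≢u refl)

  sumL-allSeqs : ∀ n m (g : Vec (Fin n) (suc m) → ℤ) →
    sumL (allSeqs n (suc m)) g ≡ ∑ n (λ v → sumL (allSeqs n m) (λ xs → g (v Vec.∷ xs)))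
  sumL-allSeqs n m g = begin
      sumL (concatMap (λ v → map (v Vec.∷_) (allSeqs n m)) (allFin n)) g
    ≡⟨ sumL-concatMap _ (allFin n) g ⟩
      sumL (allFin n) (λ v → sumL (map (v Vec.∷_) (allSeqs n m)) g)
    ≡⟨ sumL-cong (allFin n) (λ v → sumL-map (v Vec.∷_) (allSeqs n m) g) ⟩
      sumL (allFin n) (λ v → sumL (allSeqs n m) (λ xs → g (v Vec.∷ xs)))
    ≡⟨ sym (∑-as-sumL n _) ⟩
      ∑ n (λ v → sumL (allSeqs n m) (λ xs → g (v Vec.∷ xs)))
    ∎

  module Walks {n : ℕ} (M : Matrix n) where

    weight : List (Fin n × Fin n) → ℤ
    weight []             = 1ℤ
    weight ((a , b) ∷ ps) = M a b * weight ps

    pathWeight : Fin n → List (Fin n) → Fin n → ℤ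
    pathWeight u xs v = weight (consec (u ∷ xs ++ [ v ]))

    power-as-walks : ∀ m u v → (M ^M suc m) u v ≡ sumL (allSeqs n m) (λ xs → pathWeight u (toList xs) v)
    power-as-walks zero    u v = trans (∑-δ n (M u) v) (sym (trans (ℤP.+-identityʳ _) (ℤP.*-identityʳ (M u v))))
    power-as-walks (suc m) u v = begin
        ∑ n (λ w → M u w * (M ^M suc m) w v)
      ≡⟨ ∑-cong n (λ w → cong (M u w *_) (power-as-walks m w v)) ⟩
        ∑ n (λ w → M u w * sumL (allSeqs n m) (λ xs → pathWeight w (toList xs) v))
      ≡⟨ ∑-cong n (λ w → sym (sumL-scale (M u w) (allSeqs n m) _)) ⟩
        ∑ n (λ w → sumL (allSeqs n m) (λ xs → M u w * pathWeight w (toList xs) v))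
      ≡⟨ sym (sumL-allSeqs n m (λ xs → pathWeight u (toList xs) v)) ⟩
        sumL (allSeqs n (suc m)) (λ xs → pathWeight u (toList xs) v)
      ∎

    trace-as-closed-walks : ∀ m → tr (M ^M suc m) ≡ sumL (allSeqs n (suc m)) (λ w → weight (closedPairs (toList w)))
    trace-as-closed-walks m = begin
        ∑ n (λ u → (M ^M suc m) u u)
      ≡⟨ ∑-cong n (λ u → power-as-walks m u u) ⟩
        ∑ n (λ u → sumL (allSeqs n m) (λ xs → pathWeight u (toList xs) u))
      ≡⟨ sym (sumL-allSeqs n m _) ⟩
        sumL (allSeqs n (suc m)) (λ w → weight (closedPairs (toList w)))
      ∎

  open Walks using (weight)

  ⟦_⟧ : Bool → ℤ
  ⟦ true  ⟧ = 1ℤ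
  ⟦ false ⟧ = 0ℤ

  sumL-⟦⟧ : {X : Set} (p : X → Bool) (xs : List X) →
    sumL xs (λ x → ⟦ p x ⟧) ≡ + length (filter (λ x → p x ≟ᵇ true) xs)
  sumL-⟦⟧ p []       = refl
  sumL-⟦⟧ p (x ∷ xs) with p x
  ... | true  = cong (_+_ 1ℤ) (sumL-⟦⟧ p xs)
  ... | false = trans (ℤP.+-identityˡ _) (sumL-⟦⟧ p xs)

  complete : ∀ {n} → Matrix n
  complete u v = if does (u ≟ v) then 0ℤ else 1ℤ

  module _ {n : ℕ} (T : Tournament n) where

    adj-weight : ∀ ps → weight (adj T) ps ≡ + 2 * ⟦ isCycle T ps ∧ evenB (backward T ps) ⟧ - ⟦ isCycle T ps ⟧
    adj-weight []             = refl
    adj-weight ((a , b) ∷ ps) with a ≟ b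
    ... | yes _ = refl
    ... | no a≢b rewrite tourn T a b a≢b with out T a b
    ...   | true  = trans (ℤP.*-identityˡ _) (adj-weight ps)
    ...   | false = trans (cong (-1ℤ *_) (adj-weight ps)) (flip-parity (isCycle T ps) (evenB (backward T ps)))
      where
      flip-parity : ∀ c e → -1ℤ * (+ 2 * ⟦ c ∧ e ⟧ - ⟦ c ⟧) ≡ + 2 * ⟦ c ∧ not e ⟧ - ⟦ c ⟧
      flip-parity true  true  = refl
      flip-parity true  false = refl
      flip-parity false e     = refl

    complete-weight : ∀ ps → weight complete ps ≡ ⟦ isCycle T ps ⟧
    complete-weight []             = refl
    complete-weight ((a , b) ∷ ps) with a ≟ b
    ... | yes _ = refl
    ... | no _  = trans (ℤP.*-identityˡ _) (complete-weight ps)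

  -- (J − I)^k = c_k J + (−1)^k I, where with x = n − 1 the off-diagonal entry satisfies
  -- c₀ = 0 and c_{k+1} = x c_k + (−1)^k.
  offDiag : ℤ → ℕ → ℤ
  offDiag x zero    = 0ℤ
  offDiag x (suc k) = x * offDiag x k + -1ℤ ^ k

  ∑-complete : ∀ n (u : Fin n) (g : Fin n → ℤ) → ∑ n (λ w → complete u w * g w) ≡ ∑ n g - g u
  ∑-complete n u g = begin
      ∑ n (λ w → complete u w * g w)
    ≡⟨ ∑-cong n (λ w → row w) ⟩
      ∑ n (λ w → g w - g w * idM w u)
    ≡⟨ ∑-- n g _ ⟩
      ∑ n g - ∑ n (λ w → g w * idM w u)
    ≡⟨ cong (_-_ (∑ n g)) (∑-δ n g u) ⟩
      ∑ n g - g u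
    ∎
    where
    on-diagonal : ∀ y → 0ℤ * y ≡ y - y * 1ℤ
    on-diagonal = solve-∀
    off-diagonal : ∀ y → 1ℤ * y ≡ y - y * 0ℤ
    off-diagonal = solve-∀
    row : ∀ w → complete u w * g w ≡ g w - g w * idM w u
    row w with u ≟ w | w ≟ u
    ... | yes _   | yes _   = on-diagonal (g w)
    ... | no _    | no _    = off-diagonal (g w)
    ... | yes u≡w | no w≢u  = ⊥-elim (w≢u (sym u≡w))
    ... | no u≢w  | yes w≡u = ⊥-elim (u≢w (sym w≡u))

  complete-power : ∀ n k (u v : Fin n) → (complete ^M k) u v ≡ offDiag (+ n - 1ℤ) k + -1ℤ ^ k * idM u v
  complete-power n zero    u v = sym (trans (ℤP.+-identityˡ _) (ℤP.*-identityˡ _))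
  complete-power n (suc k) u v = begin
      ∑ n (λ w → complete u w * (complete ^M k) w v)
    ≡⟨ ∑-complete n u _ ⟩
      ∑ n (λ w → (complete ^M k) w v) - (complete ^M k) u v
    ≡⟨ cong₂ _-_ (∑-cong n (λ w → complete-power n k w v)) (complete-power n k u v) ⟩
      ∑ n (λ w → c + s * idM w v) - (c + s * idM u v)
    ≡⟨ cong (_- (c + s * idM u v)) (trans (∑-+ n _ _) (cong₂ _+_ (∑-const n c) (∑-δ n (λ _ → s) v))) ⟩
      + n * c + s - (c + s * idM u v)
    ≡⟨ regroup (+ n) c s (idM u v) ⟩
      (+ n - 1ℤ) * c + s + -1ℤ * s * idM u v
    ∎
    where
    c = offDiag (+ n - 1ℤ) k
    s = -1ℤ ^ k
    regroup : ∀ N c s d → N * c + s - (c + s * d) ≡ (N - 1ℤ) * c + s + -1ℤ * s * d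
    regroup = solve-∀

  offDiag-closed : ∀ x k → (1ℤ + x) * offDiag x k + -1ℤ ^ k ≡ x ^ k
  offDiag-closed x zero    = cong (_+ 1ℤ) (ℤP.*-zeroʳ (1ℤ + x))
  offDiag-closed x (suc k) = trans (step x (offDiag x k) (-1ℤ ^ k)) (cong (x *_) (offDiag-closed x k))
    where
    step : ∀ x c s → (1ℤ + x) * (x * c + s) + -1ℤ * s ≡ x * ((1ℤ + x) * c + s)
    step = solve-∀

  trace-complete-power : ∀ n k → tr (complete {n} ^M k) ≡ (+ n - 1ℤ) ^ k + (+ n - 1ℤ) * -1ℤ ^ k
  trace-complete-power n k = begin
      ∑ n (λ u → (complete ^M k) u u)
    ≡⟨ ∑-cong n (λ u → trans (complete-power n k u u) (cong (λ d → c + s * d) (idM-diag u))) ⟩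
      ∑ n (λ _ → c + s * 1ℤ)
    ≡⟨ ∑-const n _ ⟩
      + n * (c + s * 1ℤ)
    ≡⟨ regroup (+ n) c s ⟩
      ((1ℤ + x) * c + s) + x * s
    ≡⟨ cong (_+ x * s) (offDiag-closed x k) ⟩
      x ^ k + x * s
    ∎
    where
    x = + n - 1ℤ
    c = offDiag x k
    s = -1ℤ ^ k
    regroup : ∀ N c s → N * (c + s * 1ℤ) ≡ ((1ℤ + (N - 1ℤ)) * c + s) + (N - 1ℤ) * s
    regroup = solve-∀

  -1^even : ∀ j → -1ℤ ^ (2 ℕ.* j) ≡ 1ℤ
  -1^even j = trans (sym (ℤP.^-*-assoc -1ℤ 2 j)) (ℤP.^-zeroˡ j)

  pos-^ : ∀ m k → + (m ℕ.^ k) ≡ (+ m) ^ k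
  pos-^ m zero    = refl
  pos-^ m (suc k) = trans (ℤP.pos-* m (m ℕ.^ k)) (cong (+ m *_) (pos-^ m k))

  trace-complete-even : ∀ n k j → suc k ≡ 2 ℕ.* j →
    tr (complete {n} ^M suc k) ≡ + ((n ℕ.∸ 1) ℕ.^ suc k) + + (n ℕ.∸ 1)
  trace-complete-even n k (suc j) refl = trans (trace-complete-power n (2 ℕ.* suc j)) (as-naturals n)
    where
    as-naturals : ∀ n → (+ n - 1ℤ) ^ (2 ℕ.* suc j) + (+ n - 1ℤ) * -1ℤ ^ (2 ℕ.* suc j)
                        ≡ + ((n ℕ.∸ 1) ℕ.^ (2 ℕ.* suc j)) + + (n ℕ.∸ 1)
    as-naturals zero    rewrite -1^even (suc j) = refl
    as-naturals (suc m) rewrite -1^even (suc j) =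
      cong₂ _+_ (sym (pos-^ m (2 ℕ.* suc j))) (ℤP.*-identityʳ (+ m))

  trace-identity : ∀ n (T : Tournament n) k j → suc k ≡ 2 ℕ.* j →
    tr (adj T ^M suc k) ≡ + 2 * + ec (suc k) T - + ((n ℕ.∸ 1) ℕ.^ suc k) - + (n ℕ.∸ 1)
  trace-identity n T k j even = begin
      tr (adj T ^M suc k)
    ≡⟨ Walks.trace-as-closed-walks (adj T) k ⟩
      sumL S (λ w → weight (adj T) (cp w))
    ≡⟨ sumL-cong S (λ w → adj-weight T (cp w)) ⟩
      sumL S (λ w → + 2 * ⟦ isEvenCycle T w ⟧ - ⟦ isCycle T (cp w) ⟧)
    ≡⟨ sumL-- S _ _ ⟩
      sumL S (λ w → + 2 * ⟦ isEvenCycle T w ⟧) - sumL S (λ w → ⟦ isCycle T (cp w) ⟧)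
    ≡⟨ cong₂ _-_ evens cycles ⟩
      + 2 * + ec (suc k) T - (+ ((n ℕ.∸ 1) ℕ.^ suc k) + + (n ℕ.∸ 1))
    ≡⟨ subtract-sum (+ 2 * + ec (suc k) T) _ _ ⟩
      + 2 * + ec (suc k) T - + ((n ℕ.∸ 1) ℕ.^ suc k) - + (n ℕ.∸ 1)
    ∎
    where
    S = allSeqs n (suc k)
    cp : Vec (Fin n) (suc k) → List (Fin n × Fin n)
    cp w = closedPairs (toList w)
    subtract-sum : ∀ a b c → a - (b + c) ≡ a - b - c
    subtract-sum = solve-∀
    evens : sumL S (λ w → + 2 * ⟦ isEvenCycle T w ⟧) ≡ + 2 * + ec (suc k) T
    evens = trans (sumL-scale (+ 2) S _) (cong (+ 2 *_) (sumL-⟦⟧ (isEvenCycle T) S))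
    cycles : sumL S (λ w → ⟦ isCycle T (cp w) ⟧) ≡ + ((n ℕ.∸ 1) ℕ.^ suc k) + + (n ℕ.∸ 1)
    cycles = begin
        sumL S (λ w → ⟦ isCycle T (cp w) ⟧)
      ≡⟨ sumL-cong S (λ w → sym (complete-weight T (cp w))) ⟩
        sumL S (λ w → weight (complete {n}) (cp w))
      ≡⟨ sym (Walks.trace-as-closed-walks (complete {n}) k) ⟩
        tr (complete {n} ^M suc k)
      ≡⟨ trace-complete-even n k j even ⟩
        + ((n ℕ.∸ 1) ℕ.^ suc k) + + (n ℕ.∸ 1)
      ∎

module Distance where

  open import Data.Nat as ℕ using (ℕ; _≤_)
  import Data.Nat.Properties as ℕP
  open import Data.Integer using (ℤ; +_; _+_; _-_; ∣_∣)
  import Data.Integer.Properties as ℤP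
  open import Data.Integer.Tactic.RingSolver using (solve-∀)
  open import Data.Sum using (inj₁; inj₂)
  open import Data.Product using (_×_; _,_)
  open import Relation.Binary.PropositionalEquality

  distance-≤ : ∀ a b c → a ≤ b ℕ.+ c → b ≤ a ℕ.+ c → ∣ + a - + b ∣ ≤ c
  distance-≤ a b c a≤b+c b≤a+c rewrite ℤP.m-n≡m⊖n a b with ℕP.≤-total b a
  ... | inj₁ b≤a rewrite ℤP.⊖-≥ b≤a = ℕP.m≤n+o⇒m∸n≤o a b a≤b+c
  ... | inj₂ a≤b rewrite ℤP.∣m⊖n∣≡∣n⊖m∣ a b | ℤP.⊖-≥ a≤b = ℕP.m≤n+o⇒m∸n≤o b a b≤a+c

  abs-close : ∀ (a b : ℤ) c → ∣ a - b ∣ ≤ c → ∣ a ∣ ≤ ∣ b ∣ ℕ.+ c × ∣ b ∣ ≤ ∣ a ∣ ℕ.+ c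
  abs-close a b c a≈b = one-way a b a≈b , one-way b a (ℕP.≤-trans (ℕP.≤-reflexive (ℤP.∣i-j∣≡∣j-i∣ b a)) a≈b)
    where
    split : ∀ a b → a ≡ b + (a - b)
    split = solve-∀
    one-way : ∀ a b → ∣ a - b ∣ ≤ c → ∣ a ∣ ≤ ∣ b ∣ ℕ.+ c
    one-way a b a≈b = ℕP.≤-trans (ℕP.≤-reflexive (cong ∣_∣ (split a b)))
      (ℕP.≤-trans (ℤP.∣i+j∣≤∣i∣+∣j∣ b (a - b)) (ℕP.+-monoʳ-≤ ∣ b ∣ a≈b))

  shifted-close : ∀ (t E : ℤ) (P p q c : ℕ) → t ≡ E - + p - + q → ∣ + P - + (p ℕ.+ q) ∣ ≤ c →
    ∣ t ∣ ≤ ∣ E - + P ∣ ℕ.+ c × ∣ E - + P ∣ ≤ ∣ t ∣ ℕ.+ c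
  shifted-close t E P p q c refl P≈p+q = abs-close (E - + p - + q) (E - + P) c
    (subst (λ d → ∣ d ∣ ≤ c) (trans (cong (λ s → + P - s) (ℤP.pos-+ p q)) (difference E (+ P) (+ p) (+ q))) P≈p+q)
    where
    difference : ∀ E P p q → P - (p + q) ≡ E - p - q - (E - P)
    difference = solve-∀

module Asymptotics where

  open import Data.Nat
  open import Data.Nat.Properties
  open import Data.Nat.Tactic.RingSolver using (solve-∀)
  open import Data.Product using (∃; _×_; _,_; proj₁; proj₂)
  open import Function.Bundles using (_⇔_; mk⇔)
  open import Relation.Binary.PropositionalEquality
  open ≤-Reasoning

  Eventually : (ℕ → Set) → Set
  Eventually P = ∃ λ M → ∀ m → M ≤ m → P m

  eventually-both : {P Q : ℕ → Set} → Eventually P → Eventually Q → Eventually (λ m → P m × Q m)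
  eventually-both (M₁ , p) (M₂ , q) =
    M₁ ⊔ M₂ , λ m M≤m → p m (≤-trans (m≤m⊔n M₁ M₂) M≤m) , q m (≤-trans (m≤n⊔m M₁ M₂) M≤m)

  LittleO : (f g : ℕ → ℕ) → Set
  LittleO f g = ∀ j → Eventually (λ m → suc j * f m ≤ g m)

  littleO-mono : {f h g : ℕ → ℕ} → (∀ m → f m ≤ h m) → LittleO h g → LittleO f g
  littleO-mono {f} {h} {g} f≤h h≪g j with h≪g j
  ... | M , bound = M , λ m M≤m → ≤-trans (*-monoʳ-≤ (suc j) (f≤h m)) (bound m M≤m)

  littleO-halve : {f g : ℕ → ℕ} → LittleO f (λ m → 2 * g m) → LittleO f g
  littleO-halve {f} {g} f≪2g j with f≪2g (suc (2 * j))
  ... | M , bound = M , λ m M≤m → *-cancelˡ-≤ 2 (≤-trans (≤-reflexive (regroup j (f m))) (bound m M≤m))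
    where
    regroup : ∀ j y → 2 * (suc j * y) ≡ suc (suc (2 * j)) * y
    regroup = solve-∀

  littleO-double : {f g : ℕ → ℕ} → LittleO f g → LittleO f (λ m → 2 * g m)
  littleO-double {f} {g} f≪g j with f≪g j
  ... | M , bound = M , λ m M≤m → ≤-trans (bound m M≤m) (m≤n*m (g m) 2)

  littleO-+ : {f h g : ℕ → ℕ} → LittleO f g → LittleO h g → LittleO (λ m → f m + h m) g
  littleO-+ {f} {h} {g} f≪g h≪g = littleO-halve sum≪2g
    where
    sum≪2g : LittleO (λ m → f m + h m) (λ m → 2 * g m)
    sum≪2g j with eventually-both (f≪g j) (h≪g j)
    ... | M , bounds = M , λ m M≤m → begin
        suc j * (f m + h m)
      ≡⟨ *-distribˡ-+ (suc j) (f m) (h m) ⟩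
        suc j * f m + suc j * h m
      ≤⟨ +-mono-≤ (proj₁ (bounds m M≤m)) (proj₂ (bounds m M≤m)) ⟩
        g m + g m
      ≡⟨ cong (g m +_) (sym (+-identityʳ (g m))) ⟩
        2 * g m
      ∎

  littleO-transfer : (x t c P : ℕ → ℕ) →
    (∀ m → t m ≤ x m + c m) → (∀ m → x m ≤ t m + c m) → LittleO c P →
    LittleO x (λ m → 2 * P m) ⇔ LittleO t P
  littleO-transfer x t c P t≤x+c x≤t+c c≪P = mk⇔
    (λ x≪2P → littleO-mono t≤x+c (littleO-+ (littleO-halve x≪2P) c≪P))
    (λ t≪P → littleO-double (littleO-mono x≤t+c (littleO-+ t≪P c≪P)))

  bernoulli : ∀ M K → suc M ^ suc K ≤ M ^ suc K + suc K * suc M ^ K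
  bernoulli M zero    = ≤-reflexive (base M)
    where
    base : ∀ M → suc M * 1 ≡ M * 1 + 1 * 1
    base = solve-∀
  bernoulli M (suc K) = begin
      suc M * (suc M * S)
    ≤⟨ *-monoʳ-≤ (suc M) (bernoulli M K) ⟩
      suc M * (M * A + suc K * S)
    ≡⟨ expand M A S K ⟩
      M * (M * A) + (M * A + suc K * (suc M * S))
    ≤⟨ +-monoʳ-≤ (M * (M * A)) (+-monoˡ-≤ (suc K * (suc M * S)) (^-monoˡ-≤ (suc K) (n≤1+n M))) ⟩
      M * (M * A) + (suc M * S + suc K * (suc M * S))
    ≡⟨ collect M A S K ⟩
      M * (M * A) + suc (suc K) * (suc M * S)
    ∎
    where
    A = M ^ K
    S = suc M ^ K
    expand : ∀ M A S K → suc M * (M * A + suc K * S) ≡ M * (M * A) + (M * A + suc K * (suc M * S))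
    expand = solve-∀
    collect : ∀ M A S K → M * (M * A) + (suc M * S + suc K * (suc M * S)) ≡ M * (M * A) + suc (suc K) * (suc M * S)
    collect = solve-∀

  m≤m^[1+n] : ∀ m n → m ≤ m ^ suc n
  m≤m^[1+n] zero    n = z≤n
  m≤m^[1+n] (suc m) n = m≤m*n (suc m) (suc m ^ n) {{>-nonZero (m^n>0 (suc m) n)}}

  power-gap-upper : ∀ N K → (N ∸ 1) ^ suc (suc K) + (N ∸ 1) ≤ N ^ suc (suc K) + suc (suc K) * N ^ suc K
  power-gap-upper N K = +-mono-≤ (^-monoˡ-≤ (suc (suc K)) (m∸n≤m N 1))
    (≤-trans (m∸n≤m N 1) (≤-trans (m≤m^[1+n] N K) (m≤n*m (N ^ suc K) (suc (suc K)))))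

  power-gap-lower : ∀ N K → N ^ suc K ≤ ((N ∸ 1) ^ suc K + (N ∸ 1)) + suc K * N ^ K
  power-gap-lower zero    K = z≤n
  power-gap-lower (suc M) K =
    ≤-trans (bernoulli M K) (+-monoˡ-≤ (suc K * suc M ^ K) (m≤m+n (M ^ suc K) M))

  lower-order-negligible : (N : ℕ → ℕ) → (∀ B → Eventually (λ m → B ≤ N m)) → ∀ k K →
    LittleO (λ m → k * N m ^ K) (λ m → N m ^ suc K)
  lower-order-negligible N N→∞ k K j with N→∞ (suc j * k)
  ... | M , large = M , λ m M≤m → begin
      suc j * (k * N m ^ K)
    ≡⟨ sym (*-assoc (suc j) k (N m ^ K)) ⟩
      suc j * k * N m ^ K
    ≤⟨ *-monoˡ-≤ (N m ^ K) (large m M≤m) ⟩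
      N m * N m ^ K
    ∎

open import Data.Nat using (ℕ; suc; _+_; _≤_; _^_; _∸_; _*_; s≤s)
open import Data.Integer using (+_; _-_; ∣_∣) renaming (_*_ to _*ℤ_)
open import Data.Product using (_×_; ∃; _,_; proj₁; proj₂)
open import Function.Bundles using (_⇔_)
open import Relation.Binary.PropositionalEquality using (_≡_)

open TraceIdentity using (trace-identity)
open Asymptotics using (Eventually; LittleO; littleO-transfer; lower-order-negligible; power-gap-lower; power-gap-upper)
open Distance using (distance-≤; shifted-close)

trace-near-centred-count : ∀ K j → suc (suc K) ≡ 2 * j → ∀ n (T : Tournament n) →
  let k = suc (suc K)
      t = ∣ tr (adj T ^M k) ∣
      x = ∣ (+ 2) *ℤ (+ ec k T) - + (n ^ k) ∣
  in t ≤ x + k * n ^ suc K × x ≤ t + k * n ^ suc K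
trace-near-centred-count K j even n T =
  shifted-close (tr (adj T ^M k)) ((+ 2) *ℤ (+ ec k T)) (n ^ k) ((n ∸ 1) ^ k) (n ∸ 1) (k * n ^ suc K)
    (trace-identity n T (suc K) j even)
    (distance-≤ (n ^ k) ((n ∸ 1) ^ k + (n ∸ 1)) (k * n ^ suc K) (power-gap-lower n (suc K)) (power-gap-upper n K))
  where
  k = suc (suc K)

-- Claim 2.2.
claim2p2 : (k : ℕ) → 4 ≤ k → ∃ (λ j → k ≡ 2 * j) →
    ((n : ℕ) (T : Tournament n) →
      tr (adj T ^M k) ≡ (+ 2) *ℤ (+ ec k T) - + ((n ∸ 1) ^ k) - + (n ∸ 1))
    × ((N : ℕ → ℕ) (T : (m : ℕ) → Tournament (N m)) →
       (∀ B → ∃ λ M → ∀ m → M ≤ m → B ≤ N m) →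
       ((∀ j → ∃ λ M → ∀ m → M ≤ m →
            suc j * ∣ (+ 2) *ℤ (+ ec k (T m)) - + (N m ^ k) ∣ ≤ 2 * N m ^ k)
        ⇔
        (∀ j → ∃ λ M → ∀ m → M ≤ m →
            suc j * ∣ tr (adj (T m) ^M k) ∣ ≤ N m ^ k)))
claim2p2 (suc (suc K)) (s≤s (s≤s _)) (j , even) = identity , equivalence
  where
  k = suc (suc K)
  identity : (n : ℕ) (T : Tournament n) →
    tr (adj T ^M k) ≡ (+ 2) *ℤ (+ ec k T) - + ((n ∸ 1) ^ k) - + (n ∸ 1)
  identity n T = trace-identity n T (suc K) j even
  equivalence : (N : ℕ → ℕ) (T : (m : ℕ) → Tournament (N m)) →
    (∀ B → Eventually (λ m → B ≤ N m)) →
    LittleO (λ m → ∣ (+ 2) *ℤ (+ ec k (T m)) - + (N m ^ k) ∣) (λ m → 2 * N m ^ k)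
    ⇔ LittleO (λ m → ∣ tr (adj (T m) ^M k) ∣) (λ m → N m ^ k)
  equivalence N T N→∞ =
    littleO-transfer
      (λ m → ∣ (+ 2) *ℤ (+ ec k (T m)) - + (N m ^ k) ∣) (λ m → ∣ tr (adj (T m) ^M k) ∣)
      (λ m → k * N m ^ suc K) (λ m → N m ^ k)
      (λ m → proj₁ (trace-near-centred-count K j even (N m) (T m)))
      (λ m → proj₂ (trace-near-centred-count K j even (N m) (T m)))
      (lower-order-negligible N N→∞ k (suc K))
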